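{- Let $n\in\mathbb{N}$. For every $2\le i\le n$, the $i$th coefficient of $p_n$ (with respect to the ordering $\prec$ of $\mathcal{A}_n$) equals $n+1-i$. In particular, every natural number is a coefficient of $p_n$ for infinitely many $n$.
   Context: For $n\in\mathbb{N}$ and indeterminates $x_1,\ldots,x_n$, let $p_n=x_1(x_1+x_2)\cdots(x_1+x_2+\cdots+x_n)$. Let $\mathbb{N}_0=\mathbb{N}\cup\{0\}$ and $\mathcal{A}_n=\{(a_1,\ldots,a_n)\in\mathbb{N}_0^n : \sum_{i=k+1}^n a_i\le n-k \text{ for all } 1\le k\le n-1,\ \sum_{i=1}^n a_i=n\}$; these are exactly the exponent vectors of the monomials of $p_n$. For $a\in\mathcal{A}_n$, $c_a$ denotes the coefficient of $x_1^{a_1}\cdots x_n^{a_n}$ in the expansion of $p_n$. Order $\mathcal{A}_n$ as follows: for distinct $a,b\in\mathcal{A}_n$ with $k=\min\{i : a_i\ne b_i\}$, write $a\prec b$ if $a_k>b_k$ (lexicographic, decreasing). The $i$th coefficient of $p_n$ is $c_a$ for the $i$th element $a$ of $\mathcal{A}_n$ in this order. -}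

module Defs where

open import Data.Nat using (ℕ; zero; suc; _+_; _*_; _∸_; _≤ᵇ_; _<ᵇ_; _≡ᵇ_)
import Data.Nat as ℕ
open import Data.Bool using (Bool; true; false; _∧_; _∨_; if_then_else_)
open import Data.Nat.ListAction using (sum)
open import Data.Fin using (Fin; toℕ)
open import Data.List using (List; []; _∷_; map; concatMap; foldr; filter; length; upTo; drop; allFin)
open import Data.Vec using (Vec; []; _∷_; replicate; _[_]≔_; zipWith; toList)
open import Data.Vec.Properties using (≡-dec)
open import Data.Product using (_×_; _,_)
open import Relation.Nullary using (does)

-- Multivariate polynomials in x_1..x_n with ℕ coefficients, represented as
-- an (unreduced) list of terms  c · x^a  with exponent vector a : Vec ℕ n.
Term : ℕ → Set
Term n = ℕ × Vec ℕ n

Poly : ℕ → Set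
Poly n = List (Term n)

oneP : (n : ℕ) → Poly n
oneP n = (1 , replicate n 0) ∷ []

-- unit exponent vector e_j (monomial x_{j+1})
unitExp : {n : ℕ} → Fin n → Vec ℕ n
unitExp {n} j = replicate n 0 [ j ]≔ 1

linear : (n k : ℕ) → Poly n
linear n k = map (λ j → (1 , unitExp j)) (filter (λ j → toℕ j ℕ.<? k) (allFin n))

_*P_ : {n : ℕ} → Poly n → Poly n → Poly n
p *P q = concatMap (λ { (c , a) → map (λ { (d , b) → (c * d , zipWith _+_ a b) }) q }) p

-- p_n = x_1 (x_1 + x_2) ... (x_1 + ... + x_n)
p : (n : ℕ) → Poly n
p n = foldr _*P_ (oneP n) (map (λ k → linear n (suc k)) (upTo n))

coeff : {n : ℕ} → Poly n → Vec ℕ n → ℕ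
coeff q a = sum (map (λ { (c , b) → if does (≡-dec ℕ._≟_ b a) then c else 0 }) q)

-- the conditions defining 𝒜_n:
--   sum_{i=k+1}^n a_i ≤ n - k  for 1 ≤ k ≤ n-1,  and  sum_i a_i = n
tailConds : (n : ℕ) → List ℕ → Bool
tailConds n as = foldr (λ k r → (sum (drop k as) ≤ᵇ (n ∸ k)) ∧ r) true
                       (map suc (upTo (n ∸ 1)))

inA : (n : ℕ) → Vec ℕ n → Bool
inA n a = tailConds n (toList a) ∧ (sum (toList a) ≡ᵇ n)

-- b ≺ a : at the first index k where they differ, b_k > a_k
lexBefore : {n : ℕ} → Vec ℕ n → Vec ℕ n → Bool
lexBefore [] [] = false
lexBefore (x ∷ xs) (y ∷ ys) = (y <ᵇ x) ∨ ((x ≡ᵇ y) ∧ lexBefore xs ys)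

-- all vectors of length m with entries in {0,…,n}  (contains 𝒜_n when m = n)
boxes : (m n : ℕ) → List (Vec ℕ m)
boxes zero n = [] ∷ []
boxes (suc m) n = concatMap (λ x → map (x ∷_) (boxes m n)) (upTo (suc n))

-- number of elements b ∈ 𝒜_n with b ≺ a ; a ∈ 𝒜_n is the i-th element iff this is i - 1
rank : (n : ℕ) → Vec ℕ n → ℕ
rank n a = length (filter (λ b → (inA n b ∧ lexBefore b a) Data.Bool.≟ true) (boxes n n))

-- The elements of rank 1, …, n − 1 of 𝒜_n are the exponents (n − 1, e_r) of x₁ⁿ⁻¹ x_{r+2}, r = 0, …, n − 2:
-- an element of 𝒜_n preceding one of them has first entry n − 1 or n, so it is either (n, 0, …, 0) or
-- some (n − 1, e_s) with s < r.  As the rank is strictly monotone along ≺, it is injective on 𝒜_n, so no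
-- other element has these ranks.  Expanding p_n, the monomial x₁ⁿ⁻¹ x_{r+2} is obtained exactly by taking
-- x_{r+2} from one factor x₁ + ⋯ + x_k with k ≥ r + 2 and x₁ from all the others, so its coefficient is
-- n − r − 1.  Every k ≥ 1 is then the (N + 2)th coefficient of p_{N+k+1}, for every N.
module Submission where

open import Defs
open import Data.Bool using (Bool; true; false; T; _∧_; if_then_else_)
import Data.Bool as Bool
open import Data.Bool.Properties using (T-≡; T-∧; ∧-zeroʳ; ∧-identityʳ)
open import Data.Empty using (⊥-elim)
open import Data.Fin using (Fin; toℕ; fromℕ<) renaming (zero to fzero; suc to fsuc)
open import Data.Fin.Properties using (toℕ-fromℕ<) renaming (suc-injective to fsuc-injective)
open import Data.List using (List; foldr; []; _∷_; _++_; [_]; map; concatMap; filter; length; upTo; applyUpTo; tabulate; allFin; drop)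
open import Data.List.Properties
  using (length-++; filter-++; filter-accept; filter-reject; map-++; map-∘; map-cong; map-upTo; map-applyUpTo; upTo-∷ʳ; map-tabulate; length-applyUpTo; drop-all)
open import Data.List.Membership.Propositional using (_∈_)
open import Data.List.Membership.Propositional.Properties using (∈-map⁺; ∈-concat⁺′; ∈-upTo⁺)
open import Data.List.Relation.Unary.Any using (here; there)
open import Data.Nat using (ℕ; zero; suc; _+_; _*_; _∸_; _≤_; _<_; z≤n; s≤s; _≤ᵇ_; _<ᵇ_; _≡ᵇ_; _<?_)
open import Data.Nat.ListAction using (sum)
open import Data.Nat.ListAction.Properties using (sum-++)
open import Data.Nat.Properties
open import Data.Product using (Σ; _×_; _,_; proj₂)
open import Data.Sum using (_⊎_; inj₁; inj₂)
open import Data.Vec using (Vec; []; _∷_; replicate; zipWith; toList; lookup)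
import Data.Vec as Vec
open import Data.Vec.Properties using (≡-dec; length-toList; lookup-replicate; lookup-zipWith; lookup∘update; lookup∘update′; zipWith-identityˡ; zipWith-identityʳ)
open import Function using (_∘_; flip; Equivalence)
open import Relation.Binary.Definitions using (tri<; tri≈; tri>)
open import Relation.Binary.PropositionalEquality hiding ([_])
open import Relation.Nullary using (¬_; Dec; does; yes; no)
open import Relation.Nullary.Decidable using (dec-true; dec-false)

T⇒≡true : ∀ {b} → T b → b ≡ true
T⇒≡true = Equivalence.to T-≡

≡true⇒T : ∀ {b} → b ≡ true → T b
≡true⇒T = Equivalence.from T-≡

¬T⇒≡false : ∀ {b} → ¬ T b → b ≡ false
¬T⇒≡false {false} _  = refl
¬T⇒≡false {true}  ¬t = ⊥-elim (¬t _)

≡ᵇ-true : ∀ {m n} → m ≡ n → (m ≡ᵇ n) ≡ true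
≡ᵇ-true {m} {n} m≡n = T⇒≡true (≡⇒≡ᵇ m n m≡n)

≡ᵇ-false : ∀ {m n} → ¬ m ≡ n → (m ≡ᵇ n) ≡ false
≡ᵇ-false {m} {n} m≢n = ¬T⇒≡false (m≢n ∘ ≡ᵇ⇒≡ m n)

<ᵇ-true : ∀ {m n} → m < n → (m <ᵇ n) ≡ true
<ᵇ-true m<n = T⇒≡true (<⇒<ᵇ m<n)

<ᵇ-false : ∀ {m n} → ¬ m < n → (m <ᵇ n) ≡ false
<ᵇ-false {m} {n} m≮n = ¬T⇒≡false (m≮n ∘ <ᵇ⇒< m n)

private
  variable
    A B : Set

tally : (A → Bool) → List A → ℕ
tally f xs = length (filter (λ x → f x Bool.≟ true) xs)

tally-++ : (f : A → Bool) (xs ys : List A) → tally f (xs ++ ys) ≡ tally f xs + tally f ys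
tally-++ f xs ys = trans (cong length (filter-++ _ xs ys)) (length-++ (filter _ xs))

tally-none : (f : A → Bool) → (∀ x → f x ≡ false) → (xs : List A) → tally f xs ≡ 0
tally-none f none []       = refl
tally-none f none (x ∷ xs) rewrite none x = tally-none f none xs

tally-cong : {f g : A → Bool} → (∀ x → f x ≡ g x) → (xs : List A) → tally f xs ≡ tally g xs
tally-cong f≗g [] = refl
tally-cong {f = f} {g = g} f≗g (x ∷ xs) with f x | g x | f≗g x
... | true  | .true  | refl = cong suc (tally-cong f≗g xs)
... | false | .false | refl = tally-cong f≗g xs

tally-map : (f : B → Bool) (g : A → B) (xs : List A) → tally f (map g xs) ≡ tally (f ∘ g) xs
tally-map f g []       = refl
tally-map f g (x ∷ xs) with f (g x)
... | true  = cong suc (tally-map f g xs)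
... | false = tally-map f g xs

tally-concatMap : (f : B → Bool) (h : A → List B) (xs : List A) →
                  tally f (concatMap h xs) ≡ sum (map (tally f ∘ h) xs)
tally-concatMap f h []       = refl
tally-concatMap f h (x ∷ xs) =
  trans (tally-++ f (h x) (concatMap h xs)) (cong (tally f (h x) +_) (tally-concatMap f h xs))

tally-mono : {f g : A → Bool} → (∀ x → T (f x) → T (g x)) → (xs : List A) → tally f xs ≤ tally g xs
tally-mono f⇒g [] = z≤n
tally-mono {f = f} {g = g} f⇒g (x ∷ xs) with f x | g x | f⇒g x
... | true  | true  | _   = s≤s (tally-mono f⇒g xs)
... | true  | false | imp = ⊥-elim (imp _)
... | false | true  | _   = m≤n⇒m≤1+n (tally-mono f⇒g xs)
... | false | false | _   = tally-mono f⇒g xs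

tally-mono-< : {f g : A → Bool} → (∀ x → T (f x) → T (g x)) →
               ∀ {y} {xs : List A} → y ∈ xs → T (g y) → ¬ T (f y) → tally f xs < tally g xs
tally-mono-< {f = f} {g = g} f⇒g {xs = x ∷ xs} (here refl) gy ¬fy
  rewrite T⇒≡true gy | ¬T⇒≡false ¬fy = s≤s (tally-mono f⇒g xs)
tally-mono-< {f = f} {g = g} f⇒g {xs = x ∷ xs} (there y∈xs) gy ¬fy
  with ih ← tally-mono-< f⇒g y∈xs gy ¬fy | f x | g x | f⇒g x
... | true  | true  | _   = s≤s ih
... | true  | false | imp = ⊥-elim (imp _)
... | false | true  | _   = m<n⇒m<1+n ih
... | false | false | _   = ih

sum-upTo-suc : (h : ℕ → ℕ) (K : ℕ) → sum (map h (upTo (suc K))) ≡ h 0 + sum (map (h ∘ suc) (upTo K))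
sum-upTo-suc h K = cong (λ xs → h 0 + sum xs) (trans (map-applyUpTo suc h K) (sym (map-upTo (h ∘ suc) K)))

sum-upTo-∷ʳ : (h : ℕ → ℕ) (K : ℕ) → sum (map h (upTo (suc K))) ≡ sum (map h (upTo K)) + h K
sum-upTo-∷ʳ h K = begin
  sum (map h (upTo (suc K)))          ≡⟨ cong (sum ∘ map h) (upTo-∷ʳ K) ⟨
  sum (map h (upTo K ++ [ K ]))       ≡⟨ cong sum (map-++ h (upTo K) [ K ]) ⟩
  sum (map h (upTo K) ++ [ h K ])     ≡⟨ sum-++ (map h (upTo K)) [ h K ] ⟩
  sum (map h (upTo K)) + (h K + 0)    ≡⟨ cong (sum (map h (upTo K)) +_) (+-identityʳ (h K)) ⟩
  sum (map h (upTo K)) + h K          ∎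
  where open ≡-Reasoning

sum-upTo-zero : (h : ℕ → ℕ) (K : ℕ) → (∀ x → x < K → h x ≡ 0) → sum (map h (upTo K)) ≡ 0
sum-upTo-zero h zero    _    = refl
sum-upTo-zero h (suc K) h≡0 = begin
  sum (map h (upTo (suc K)))         ≡⟨ sum-upTo-∷ʳ h K ⟩
  sum (map h (upTo K)) + h K         ≡⟨ cong₂ _+_ (sum-upTo-zero h K (λ x x<K → h≡0 x (m<n⇒m<1+n x<K))) (h≡0 K ≤-refl) ⟩
  0                                  ∎
  where open ≡-Reasoning

tally-boxes : ∀ {m} (f : Vec ℕ (suc m) → Bool) (N : ℕ) →
              tally f (boxes (suc m) N) ≡ sum (map (λ x → tally (f ∘ (x ∷_)) (boxes m N)) (upTo (suc N)))
tally-boxes {m} f N =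
  trans (tally-concatMap f (λ x → map (x ∷_) (boxes m N)) (upTo (suc N)))
        (cong sum (map-cong (λ x → tally-map f (x ∷_) (boxes m N)) (upTo (suc N))))

∈-boxes : ∀ {m} N (b : Vec ℕ m) → sum (toList b) ≤ N → b ∈ boxes m N
∈-boxes N []      _   = here refl
∈-boxes N (x ∷ b) x+b≤N =
  ∈-concat⁺′ (∈-map⁺ (x ∷_) (∈-boxes N b (≤-trans (m≤n+m _ x) x+b≤N)))
             (∈-map⁺ (λ y → map (y ∷_) (boxes _ N)) (∈-upTo⁺ (s≤s (≤-trans (m≤m+n x _) x+b≤N))))

tally-zeroVec-boxes : ∀ m N → tally (λ t → sum (toList t) ≡ᵇ 0) (boxes m N) ≡ 1
tally-zeroVec-boxes zero    N = refl
tally-zeroVec-boxes (suc m) N = begin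
  tally isZero (boxes (suc m) N)                                        ≡⟨ tally-boxes isZero N ⟩
  sum (map (λ x → tally (isZero ∘ (x ∷_)) (boxes m N)) (upTo (suc N)))  ≡⟨ sum-upTo-suc _ N ⟩
  tally (λ t → sum (toList t) ≡ᵇ 0) (boxes m N) + sum (map (λ x → tally (isZero ∘ (suc x ∷_)) (boxes m N)) (upTo N))
    ≡⟨ cong₂ _+_ (tally-zeroVec-boxes m N) (sum-upTo-zero _ N (λ x _ → tally-none _ (λ _ → refl) (boxes m N))) ⟩
  1                                                                     ∎
  where
  open ≡-Reasoning
  isZero : Vec ℕ (suc m) → Bool
  isZero t = sum (toList t) ≡ᵇ 0

zeroVec-not-before : ∀ {m} (t : Vec ℕ m) → ((sum (toList t) ≡ᵇ 0) ∧ lexBefore t (replicate m 0)) ≡ false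
zeroVec-not-before []          = refl
zeroVec-not-before (zero  ∷ t) = zeroVec-not-before t
zeroVec-not-before (suc _ ∷ t) = refl

tally-unitVec-before : ∀ {m} N (r : Fin m) →
  tally (λ t → (sum (toList t) ≡ᵇ 1) ∧ lexBefore t (unitExp r)) (boxes m (suc N)) ≡ toℕ r
tally-unitVec-before {suc m} N fzero = tally-none _ none (boxes (suc m) (suc N))
  where
  none : (t : Vec ℕ (suc m)) → ((sum (toList t) ≡ᵇ 1) ∧ lexBefore t (unitExp fzero)) ≡ false
  none (zero        ∷ t) = ∧-zeroʳ _
  none (suc zero    ∷ t) = zeroVec-not-before t
  none (suc (suc _) ∷ t) = refl
tally-unitVec-before {suc m} N (fsuc r) = begin
  tally isBefore (boxes (suc m) (suc N))                       ≡⟨ tally-boxes isBefore (suc N) ⟩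
  sum (map h (upTo (suc (suc N))))                             ≡⟨ sum-upTo-suc h (suc N) ⟩
  h 0 + sum (map (h ∘ suc) (upTo (suc N)))                     ≡⟨ cong (h 0 +_) (sum-upTo-suc (h ∘ suc) N) ⟩
  h 0 + (h 1 + rest)                                           ≡⟨ cong₂ (λ a b → a + (b + rest)) (tally-unitVec-before N r) h1≡1 ⟩
  toℕ r + (1 + rest)                                           ≡⟨ cong (λ z → toℕ r + (1 + z)) rest≡0 ⟩
  toℕ r + 1                                                    ≡⟨ +-comm (toℕ r) 1 ⟩
  suc (toℕ r)                                                  ∎
  where
  open ≡-Reasoning
  isBefore : Vec ℕ (suc m) → Bool
  isBefore t = (sum (toList t) ≡ᵇ 1) ∧ lexBefore t (unitExp (fsuc r))
  h : ℕ → ℕ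
  h x = tally (isBefore ∘ (x ∷_)) (boxes m (suc N))
  h1≡1 : h 1 ≡ 1
  h1≡1 = trans (tally-cong (λ t → ∧-identityʳ _) (boxes m (suc N))) (tally-zeroVec-boxes m (suc N))
  rest : ℕ
  rest = sum (map (h ∘ suc ∘ suc) (upTo N))
  rest≡0 : rest ≡ 0
  rest≡0 = sum-upTo-zero _ N (λ x _ → tally-none _ (λ _ → refl) (boxes m (suc N)))

infix 4 _≺_

data _≺_ : ∀ {m} → Vec ℕ m → Vec ℕ m → Set where
  ≺-here  : ∀ {m x y} {xs ys : Vec ℕ m} → y < x → x ∷ xs ≺ y ∷ ys
  ≺-there : ∀ {m x} {xs ys : Vec ℕ m} → xs ≺ ys → x ∷ xs ≺ x ∷ ys

lexBefore⇒≺ : ∀ {m} (b a : Vec ℕ m) → T (lexBefore b a) → b ≺ a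
lexBefore⇒≺ []       []       ()
lexBefore⇒≺ (x ∷ xs) (y ∷ ys) t with y <ᵇ x in y<ᵇx | x ≡ᵇ y in x≡ᵇy
... | true  | _    = ≺-here (<ᵇ⇒< y x (≡true⇒T y<ᵇx))
... | false | true with refl ← ≡ᵇ⇒≡ x y (≡true⇒T x≡ᵇy) = ≺-there (lexBefore⇒≺ xs ys t)

≺⇒lexBefore : ∀ {m} {b a : Vec ℕ m} → b ≺ a → T (lexBefore b a)
≺⇒lexBefore (≺-here y<x) rewrite <ᵇ-true y<x = _
≺⇒lexBefore {b = x ∷ _} (≺-there xs≺ys) rewrite <ᵇ-false (<-irrefl (refl {x = x})) | ≡ᵇ-true (refl {x = x}) =
  ≺⇒lexBefore xs≺ys

≺-irrefl : ∀ {m} {a : Vec ℕ m} → ¬ a ≺ a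
≺-irrefl (≺-here x<x)  = <-irrefl refl x<x
≺-irrefl (≺-there a≺a) = ≺-irrefl a≺a

≺-trans : ∀ {m} {a b c : Vec ℕ m} → a ≺ b → b ≺ c → a ≺ c
≺-trans (≺-here  b<a)  (≺-here c<b)  = ≺-here (<-trans c<b b<a)
≺-trans (≺-here  b<a)  (≺-there _)   = ≺-here b<a
≺-trans (≺-there _)    (≺-here c<b)  = ≺-here c<b
≺-trans (≺-there a≺b)  (≺-there b≺c) = ≺-there (≺-trans a≺b b≺c)

≺-connex : ∀ {m} (a b : Vec ℕ m) → ¬ a ≡ b → a ≺ b ⊎ b ≺ a
≺-connex []       []       a≢b = ⊥-elim (a≢b refl)
≺-connex (x ∷ xs) (y ∷ ys) a≢b with <-cmp x y
... | tri< x<y _ _ = inj₂ (≺-here x<y)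
... | tri> _ _ y<x = inj₁ (≺-here y<x)
... | tri≈ _ refl _ with ≺-connex xs ys (a≢b ∘ cong (x ∷_))
...   | inj₁ xs≺ys = inj₁ (≺-there xs≺ys)
...   | inj₂ ys≺xs = inj₂ (≺-there ys≺xs)

inA⇒sum : ∀ n (a : Vec ℕ n) → T (inA n a) → sum (toList a) ≡ n
inA⇒sum n a a∈A = ≡ᵇ⇒≡ _ n (proj₂ (Equivalence.to T-∧ a∈A))

inA-false : ∀ n (a : Vec ℕ n) → ¬ sum (toList a) ≡ n → inA n a ≡ false
inA-false n a sum≢n = trans (cong (tailConds n (toList a) ∧_) (≡ᵇ-false sum≢n)) (∧-zeroʳ _)

tailConds-true : ∀ n (as : List ℕ) → (∀ k → sum (drop (suc k) as) ≤ n ∸ suc k) → tailConds n as ≡ true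
tailConds-true n as bound = go (upTo (n ∸ 1))
  where
  go : ∀ ks → foldr (λ k r → (sum (drop k as) ≤ᵇ (n ∸ k)) ∧ r) true (map suc ks) ≡ true
  go []       = refl
  go (k ∷ ks) = cong₂ _∧_ (T⇒≡true (≤⇒≤ᵇ (bound k))) (go ks)

sum-drop-≤ : ∀ k (xs : List ℕ) → sum (drop k xs) ≤ sum xs
sum-drop-≤ zero    xs       = ≤-refl
sum-drop-≤ (suc k) []       = z≤n
sum-drop-≤ (suc k) (x ∷ xs) = ≤-trans (sum-drop-≤ k xs) (m≤n+m _ x)

-- Once the head is at least n − 1, the other entries sum to at most 1, so every tail condition holds.
inA-head≥ : ∀ {m} x (t : Vec ℕ m) → m ≤ x → inA (suc m) (x ∷ t) ≡ (x + sum (toList t) ≡ᵇ suc m)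
inA-head≥ {m} x t m≤x with x + sum (toList t) ≟ suc m
... | no  sum≢ = trans (inA-false (suc m) (x ∷ t) sum≢) (sym (≡ᵇ-false sum≢))
... | yes sum≡ = cong (_∧ (x + sum (toList t) ≡ᵇ suc m)) (tailConds-true (suc m) (x ∷ toList t) bound)
  where
  tail≤1 : sum (toList t) ≤ 1
  tail≤1 = +-cancelˡ-≤ m _ 1 (begin
    m + sum (toList t) ≤⟨ +-monoˡ-≤ _ m≤x ⟩
    x + sum (toList t) ≡⟨ sum≡ ⟩
    suc m              ≡⟨ +-comm 1 m ⟩
    m + 1              ∎)
    where open ≤-Reasoning
  bound : ∀ k → sum (drop k (toList t)) ≤ m ∸ k
  bound k with k <? m
  ... | yes k<m = ≤-trans (sum-drop-≤ k (toList t)) (≤-trans tail≤1 (m<n⇒0<n∸m k<m))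
  ... | no  k≮m rewrite drop-all k (toList t) (subst (_≤ k) (sym (length-toList t)) (≮⇒≥ k≮m)) = z≤n

+-≡ᵇ-cancelˡ : ∀ m a b → (m + a ≡ᵇ m + b) ≡ (a ≡ᵇ b)
+-≡ᵇ-cancelˡ zero    a b = refl
+-≡ᵇ-cancelˡ (suc m) a b = +-≡ᵇ-cancelˡ m a b

inA-head-pred : ∀ m (t : Vec ℕ m) → inA (suc m) (m ∷ t) ≡ (sum (toList t) ≡ᵇ 1)
inA-head-pred m t = begin
  inA (suc m) (m ∷ t)             ≡⟨ inA-head≥ m t ≤-refl ⟩
  (m + sum (toList t) ≡ᵇ suc m)   ≡⟨ cong (m + sum (toList t) ≡ᵇ_) (+-comm 1 m) ⟩
  (m + sum (toList t) ≡ᵇ m + 1)   ≡⟨ +-≡ᵇ-cancelˡ m _ 1 ⟩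
  (sum (toList t) ≡ᵇ 1)           ∎
  where open ≡-Reasoning

inA-head-full : ∀ m (t : Vec ℕ m) → inA (suc m) (suc m ∷ t) ≡ (sum (toList t) ≡ᵇ 0)
inA-head-full m t = begin
  inA (suc m) (suc m ∷ t)                 ≡⟨ inA-head≥ (suc m) t (n≤1+n m) ⟩
  (suc m + sum (toList t) ≡ᵇ suc m)       ≡⟨ cong (suc m + sum (toList t) ≡ᵇ_) (+-identityʳ (suc m)) ⟨
  (suc m + sum (toList t) ≡ᵇ suc m + 0)   ≡⟨ +-≡ᵇ-cancelˡ (suc m) _ 0 ⟩
  (sum (toList t) ≡ᵇ 0)                   ∎
  where open ≡-Reasoning

nextToTop : (m : ℕ) → Fin m → Vec ℕ (suc m)
nextToTop m r = m ∷ unitExp r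

sum-unitExp : ∀ {m} (r : Fin m) → sum (toList (unitExp r)) ≡ 1
sum-unitExp {suc m} fzero    = cong suc (sum-zeros m)
  where
  sum-zeros : ∀ k → sum (toList (replicate k 0)) ≡ 0
  sum-zeros zero    = refl
  sum-zeros (suc k) = sum-zeros k
sum-unitExp         (fsuc r) = sum-unitExp r

nextToTop∈A : ∀ m (r : Fin m) → T (inA (suc m) (nextToTop m r))
nextToTop∈A m r = ≡true⇒T (trans (inA-head-pred m (unitExp r)) (≡ᵇ-true (sum-unitExp r)))

rank-nextToTop : ∀ m (r : Fin m) → rank (suc m) (nextToTop m r) ≡ suc (toℕ r)
rank-nextToTop m r = begin
  tally P (boxes (suc m) (suc m))                  ≡⟨ tally-boxes P (suc m) ⟩
  sum (map h (upTo (suc (suc m))))                 ≡⟨ sum-upTo-∷ʳ h (suc m) ⟩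
  sum (map h (upTo (suc m))) + h (suc m)           ≡⟨ cong (_+ h (suc m)) (sum-upTo-∷ʳ h m) ⟩
  sum (map h (upTo m)) + h m + h (suc m)           ≡⟨ cong₂ (λ a b → a + b + h (suc m)) (sum-upTo-zero h m below) at ⟩
  toℕ r + h (suc m)                                ≡⟨ cong (toℕ r +_) above ⟩
  toℕ r + 1                                        ≡⟨ +-comm (toℕ r) 1 ⟩
  suc (toℕ r)                                      ∎
  where
  open ≡-Reasoning
  P : Vec ℕ (suc m) → Bool
  P b = inA (suc m) b ∧ lexBefore b (nextToTop m r)
  h : ℕ → ℕ
  h x = tally (P ∘ (x ∷_)) (boxes m (suc m))
  below : ∀ x → x < m → h x ≡ 0
  below x x<m = tally-none _ none (boxes m (suc m))
    where
    none : ∀ t → P (x ∷ t) ≡ false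
    none t rewrite <ᵇ-false (<⇒≯ x<m) | ≡ᵇ-false (<⇒≢ x<m) = ∧-zeroʳ _
  at : h m ≡ toℕ r
  at = trans (tally-cong P≗ (boxes m (suc m))) (tally-unitVec-before m r)
    where
    P≗ : ∀ t → P (m ∷ t) ≡ ((sum (toList t) ≡ᵇ 1) ∧ lexBefore t (unitExp r))
    P≗ t rewrite <ᵇ-false (<-irrefl (refl {x = m})) | ≡ᵇ-true (refl {x = m}) =
      cong (_∧ lexBefore t (unitExp r)) (inA-head-pred m t)
  above : h (suc m) ≡ 1
  above = trans (tally-cong P≗ (boxes m (suc m))) (tally-zeroVec-boxes m (suc m))
    where
    P≗ : ∀ t → P (suc m ∷ t) ≡ (sum (toList t) ≡ᵇ 0)
    P≗ t rewrite <ᵇ-true (n<1+n m) = trans (∧-identityʳ _) (inA-head-full m t)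

rank-mono : ∀ n {a b : Vec ℕ n} → T (inA n b) → b ≺ a → rank n b < rank n a
rank-mono n {a} {b} b∈A b≺a =
  tally-mono-< ≺b⇒≺a (∈-boxes n b (≤-reflexive (inA⇒sum n b b∈A)))
    (Equivalence.from T-∧ (b∈A , ≺⇒lexBefore b≺a))
    (λ b≺b → ≺-irrefl (lexBefore⇒≺ b b (proj₂ (Equivalence.to T-∧ b≺b))))
  where
  ≺b⇒≺a : ∀ c → T (inA n c ∧ lexBefore c b) → T (inA n c ∧ lexBefore c a)
  ≺b⇒≺a c c≺b with (c∈A , c≺b) ← Equivalence.to T-∧ c≺b =
    Equivalence.from T-∧ (c∈A , ≺⇒lexBefore (≺-trans (lexBefore⇒≺ c b c≺b) b≺a))

rank-injective : ∀ n {a b : Vec ℕ n} → T (inA n a) → T (inA n b) → rank n a ≡ rank n b → a ≡ b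
rank-injective n {a} {b} a∈A b∈A ranks≡ with ≡-dec _≟_ a b
... | yes a≡b = a≡b
... | no  a≢b with ≺-connex a b a≢b
...   | inj₁ a≺b = ⊥-elim (<⇒≢ (rank-mono n a∈A a≺b) ranks≡)
...   | inj₂ b≺a = ⊥-elim (<⇒≢ (rank-mono n b∈A b≺a) (sym ranks≡))

sum-tabulate-zero : ∀ {n} (h : Fin n → ℕ) → (∀ j → h j ≡ 0) → sum (tabulate h) ≡ 0
sum-tabulate-zero {zero}  h h≡0 = refl
sum-tabulate-zero {suc n} h h≡0 = cong₂ _+_ (h≡0 fzero) (sum-tabulate-zero (h ∘ fsuc) (h≡0 ∘ fsuc))

sum-tabulate-point : ∀ {n} (h : Fin n → ℕ) c → (∀ j → ¬ j ≡ c → h j ≡ 0) → sum (tabulate h) ≡ h c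
sum-tabulate-point {suc n} h fzero    off =
  trans (cong (h fzero +_) (sum-tabulate-zero (h ∘ fsuc) (λ j → off (fsuc j) λ ())))
        (+-identityʳ (h fzero))
sum-tabulate-point {suc n} h (fsuc c) off =
  cong₂ _+_ (off fzero λ ()) (sum-tabulate-point (h ∘ fsuc) c (λ j j≢c → off (fsuc j) (j≢c ∘ fsuc-injective)))

sum-map-filter : ∀ {P : A → Set} (P? : ∀ x → Dec (P x)) (h : A → ℕ) (xs : List A) →
                 sum (map h (filter P? xs)) ≡ sum (map (λ x → if does (P? x) then h x else 0) xs)
sum-map-filter P? h []       = refl
sum-map-filter P? h (x ∷ xs) with does (P? x)
... | true  = cong (h x +_) (sum-map-filter P? h xs)
... | false = sum-map-filter P? h xs

if-zero : ∀ b {x} → x ≡ 0 → (if b then x else 0) ≡ 0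
if-zero true  x≡0 = x≡0
if-zero false _   = refl

coeff-++ : ∀ {n} (q q′ : Poly n) a → coeff (q ++ q′) a ≡ coeff q a + coeff q′ a
coeff-++ q q′ a = trans (cong sum (map-++ _ q q′)) (sum-++ (map _ q) _)

coeff-concatMap : ∀ {n} (G : A → Poly n) (xs : List A) a →
                  coeff (concatMap G xs) a ≡ sum (map (λ x → coeff (G x) a) xs)
coeff-concatMap G []       a = refl
coeff-concatMap G (x ∷ xs) a =
  trans (coeff-++ (G x) (concatMap G xs) a) (cong (coeff (G x) a +_) (coeff-concatMap G xs a))

timesVar : ∀ {n} → Fin n → Term n → Term n
timesVar j (d , b) = (1 * d , zipWith _+_ (unitExp j) b)

coeff-linear-*P : ∀ n l (Q : Poly n) a →
  coeff (linear n l *P Q) a ≡ sum (tabulate (λ j → if does (toℕ j <? l) then coeff (map (timesVar j) Q) a else 0))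
coeff-linear-*P n l Q a = begin
  coeff (linear n l *P Q) a
    ≡⟨ coeff-concatMap _ (map (λ j → (1 , unitExp j)) js) a ⟩
  sum (map _ (map (λ j → (1 , unitExp j)) js))
    ≡⟨ cong sum (map-∘ js) ⟨
  sum (map (λ j → coeff (map (timesVar j) Q) a) js)
    ≡⟨ sum-map-filter (λ j → toℕ j <? l) _ (allFin n) ⟩
  sum (map (λ j → if does (toℕ j <? l) then coeff (map (timesVar j) Q) a else 0) (allFin n))
    ≡⟨ cong sum (map-tabulate {n = n} (λ j → j) (λ j → if does (toℕ j <? l) then coeff (map (timesVar j) Q) a else 0)) ⟩
  sum (tabulate (λ j → if does (toℕ j <? l) then coeff (map (timesVar j) Q) a else 0)) ∎
  where
  open ≡-Reasoning
  js = filter (λ j → toℕ j <? l) (allFin n)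

zipWith-+-cancelˡ : ∀ {m} (u : Vec ℕ m) {b b′ : Vec ℕ m} → zipWith _+_ u b ≡ zipWith _+_ u b′ → b ≡ b′
zipWith-+-cancelˡ []      {[]}    {[]}      _  = refl
zipWith-+-cancelˡ (x ∷ u) {y ∷ b} {y′ ∷ b′} eq =
  cong₂ _∷_ (+-cancelˡ-≡ x y y′ (cong Vec.head eq)) (zipWith-+-cancelˡ u (cong Vec.tail eq))

coeff-timesVar : ∀ {n} (j : Fin n) (Q : Poly n) {a} b → a ≡ zipWith _+_ (unitExp j) b →
                 coeff (map (timesVar j) Q) a ≡ coeff Q b
coeff-timesVar j []             b a≡ = refl
coeff-timesVar j ((d , b′) ∷ Q) b a≡ with ≡-dec _≟_ b′ b
... | yes refl rewrite dec-true (≡-dec _≟_ (zipWith _+_ (unitExp j) b′) _) (sym a≡) =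
  cong₂ _+_ (+-identityʳ d) (coeff-timesVar j Q b a≡)
... | no  b′≢b rewrite dec-false (≡-dec _≟_ (zipWith _+_ (unitExp j) b′) _) (b′≢b ∘ zipWith-+-cancelˡ _ ∘ flip trans a≡) =
  coeff-timesVar j Q b a≡

lookup-+unitExp : ∀ {n} (j : Fin n) (b : Vec ℕ n) → lookup (zipWith _+_ (unitExp j) b) j ≡ suc (lookup b j)
lookup-+unitExp j b =
  trans (lookup-zipWith _+_ j (unitExp j) b) (cong (_+ lookup b j) (lookup∘update j (replicate _ 0) 1))

coeff-timesVar-absent : ∀ {n} (j : Fin n) (Q : Poly n) a → lookup a j ≡ 0 → coeff (map (timesVar j) Q) a ≡ 0
coeff-timesVar-absent j []            a aⱼ≡0 = refl
coeff-timesVar-absent j ((d , b) ∷ Q) a aⱼ≡0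
  rewrite dec-false (≡-dec _≟_ (zipWith _+_ (unitExp j) b) a)
                    (λ eq → 0≢1+n (trans (sym aⱼ≡0) (trans (cong (λ v → lookup v j) (sym eq)) (lookup-+unitExp j b)))) =
  coeff-timesVar-absent j Q a aⱼ≡0

linearProduct : (n : ℕ) → List ℕ → Poly n
linearProduct n ks = foldr _*P_ (oneP n) (map (λ k → linear n (suc k)) ks)

coeff-x₁-power : ∀ m ks → coeff (linearProduct (suc m) ks) (length ks ∷ replicate m 0) ≡ 1
coeff-x₁-power m [] rewrite dec-true (≡-dec _≟_ (replicate (suc m) 0) (0 ∷ replicate m 0)) refl = refl
coeff-x₁-power m (k ∷ ks) = begin
  coeff (linear (suc m) (suc k) *P Q) a          ≡⟨ coeff-linear-*P (suc m) (suc k) Q a ⟩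
  sum (tabulate h)                               ≡⟨ sum-tabulate-point h fzero off ⟩
  coeff (map (timesVar fzero) Q) a               ≡⟨ coeff-timesVar fzero Q (length ks ∷ replicate m 0) a≡ ⟩
  coeff Q (length ks ∷ replicate m 0)            ≡⟨ coeff-x₁-power m ks ⟩
  1                                              ∎
  where
  open ≡-Reasoning
  Q = linearProduct (suc m) ks
  a = length (k ∷ ks) ∷ replicate m 0
  h : Fin (suc m) → ℕ
  h j = if does (toℕ j <? suc k) then coeff (map (timesVar j) Q) a else 0
  off : ∀ j → ¬ j ≡ fzero → h j ≡ 0
  off fzero    j≢0 = ⊥-elim (j≢0 refl)
  off (fsuc j) _   =
    if-zero (does (toℕ (fsuc j) <? suc k)) (coeff-timesVar-absent (fsuc j) Q a (lookup-replicate j 0))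
  a≡ : a ≡ zipWith _+_ (unitExp fzero) (length ks ∷ replicate m 0)
  a≡ = cong (suc (length ks) ∷_) (sym (zipWith-identityˡ +-identityˡ (replicate m 0)))

length-filter-∷ : ∀ {P : A → Set} (P? : ∀ x → Dec (P x)) x xs →
                  length (filter P? (x ∷ xs)) ≡ length (filter P? xs) + (if does (P? x) then 1 else 0)
length-filter-∷ P? x xs with does (P? x)
... | true  = +-comm 1 _
... | false = sym (+-identityʳ _)

coeff-x₁-power-xᵣ : ∀ m (r : Fin m) k ks →
  coeff (linearProduct (suc m) (k ∷ ks)) (length ks ∷ unitExp r) ≡ length (filter (toℕ r <?_) (k ∷ ks))
coeff-x₁-power-xᵣ m r k ks = begin
  coeff (linear (suc m) (suc k) *P Q) a          ≡⟨ coeff-linear-*P (suc m) (suc k) Q a ⟩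
  h fzero + sum (tabulate (h ∘ fsuc))            ≡⟨ cong (h fzero +_) (sum-tabulate-point (h ∘ fsuc) r off) ⟩
  h fzero + h (fsuc r)                           ≡⟨ cong₂ _+_ (x₁-term ks) (cong (if does (toℕ r <? k) then_else 0) xᵣ-term) ⟩
  length (filter (toℕ r <?_) ks) + (if does (toℕ r <? k) then 1 else 0)
                                                 ≡⟨ length-filter-∷ (toℕ r <?_) k ks ⟨
  length (filter (toℕ r <?_) (k ∷ ks))           ∎
  where
  open ≡-Reasoning
  Q = linearProduct (suc m) ks
  a = length ks ∷ unitExp r
  h : Fin (suc m) → ℕ
  h j = if does (toℕ j <? suc k) then coeff (map (timesVar j) Q) a else 0
  off : ∀ j → ¬ j ≡ r → h (fsuc j) ≡ 0
  off j j≢r = if-zero (does (toℕ (fsuc j) <? suc k))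
    (coeff-timesVar-absent (fsuc j) Q a (trans (lookup∘update′ j≢r (replicate m 0) 1) (lookup-replicate j 0)))
  xᵣ-term : coeff (map (timesVar (fsuc r)) Q) a ≡ 1
  xᵣ-term =
    trans (coeff-timesVar (fsuc r) Q (length ks ∷ replicate m 0)
                          (cong (length ks ∷_) (sym (zipWith-identityʳ +-identityʳ (unitExp r)))))
          (coeff-x₁-power m ks)
  x₁-term : ∀ ks → coeff (map (timesVar fzero) (linearProduct (suc m) ks)) (length ks ∷ unitExp r)
                    ≡ length (filter (toℕ r <?_) ks)
  x₁-term []         = coeff-timesVar-absent fzero (oneP (suc m)) (0 ∷ unitExp r) refl
  x₁-term (k′ ∷ ks′) =
    trans (coeff-timesVar fzero (linearProduct (suc m) (k′ ∷ ks′)) (length ks′ ∷ unitExp r)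
                          (cong (length (k′ ∷ ks′) ∷_) (sym (zipWith-identityˡ +-identityˡ (unitExp r)))))
          (coeff-x₁-power-xᵣ m r k′ ks′)

length-filter-<-upTo : ∀ q K → length (filter (q <?_) (upTo K)) ≡ K ∸ suc q
length-filter-<-upTo q zero    = refl
length-filter-<-upTo q (suc K) = begin
  length (filter (q <?_) (upTo (suc K)))                                ≡⟨ cong (length ∘ filter (q <?_)) (upTo-∷ʳ K) ⟨
  length (filter (q <?_) (upTo K ++ [ K ]))                             ≡⟨ cong length (filter-++ (q <?_) (upTo K) [ K ]) ⟩
  length (filter (q <?_) (upTo K) ++ filter (q <?_) [ K ])              ≡⟨ length-++ (filter (q <?_) (upTo K)) ⟩
  length (filter (q <?_) (upTo K)) + length (filter (q <?_) [ K ])      ≡⟨ cong (_+ length (filter (q <?_) [ K ])) (length-filter-<-upTo q K) ⟩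
  K ∸ suc q + length (filter (q <?_) [ K ])                             ≡⟨ last ⟩
  K ∸ q                                                                 ∎
  where
  open ≡-Reasoning
  last : K ∸ suc q + length (filter (q <?_) [ K ]) ≡ K ∸ q
  last with q <? K
  ... | yes q<K rewrite filter-accept (q <?_) {xs = []} q<K = trans (+-comm (K ∸ suc q) 1) (sym (+-∸-assoc 1 q<K))
  ... | no  q≮K rewrite filter-reject (q <?_) {xs = []} q≮K =
    trans (+-identityʳ _) (trans (m≤n⇒m∸n≡0 (m≤n⇒m≤1+n K≤q)) (sym (m≤n⇒m∸n≡0 K≤q)))
    where K≤q = ≮⇒≥ q≮K

coeff-nextToTop : ∀ m (r : Fin m) → coeff (p (suc m)) (nextToTop m r) ≡ m ∸ toℕ r
coeff-nextToTop m r = begin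
  coeff (p (suc m)) (m ∷ unitExp r)
    ≡⟨ cong (λ l → coeff (p (suc m)) (l ∷ unitExp r)) (length-applyUpTo suc m) ⟨
  coeff (linearProduct (suc m) (0 ∷ ks)) (length ks ∷ unitExp r)    ≡⟨ coeff-x₁-power-xᵣ m r 0 ks ⟩
  length (filter (toℕ r <?_) (upTo (suc m)))                        ≡⟨ length-filter-<-upTo (toℕ r) (suc m) ⟩
  m ∸ toℕ r                                                         ∎
  where
  open ≡-Reasoning
  ks = applyUpTo suc m

ith-coefficient : ∀ n i → 2 ≤ i → i ≤ n →
  Σ (Vec ℕ n) (λ a → T (inA n a) × rank n a ≡ i ∸ 1)
  × ((a : Vec ℕ n) → T (inA n a) → rank n a ≡ i ∸ 1 → coeff (p n) a ≡ n + 1 ∸ i)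
ith-coefficient (suc m) (suc (suc j)) (s≤s (s≤s z≤n)) (s≤s j<m) =
  (nextToTop m r , nextToTop∈A m r , rank≡) , coeff≡
  where
  r = fromℕ< j<m
  rank≡ : rank (suc m) (nextToTop m r) ≡ suc j
  rank≡ = trans (rank-nextToTop m r) (cong suc (toℕ-fromℕ< j<m))
  coeff≡ : ∀ a → T (inA (suc m) a) → rank (suc m) a ≡ suc j → coeff (p (suc m)) a ≡ suc m + 1 ∸ suc (suc j)
  coeff≡ a a∈A rank-a rewrite rank-injective (suc m) a∈A (nextToTop∈A m r) (trans rank-a (sym rank≡))
                            | +-comm m 1 =
    trans (coeff-nextToTop m r) (cong (m ∸_) (toℕ-fromℕ< j<m))

coefficient-recurs : ∀ k → 1 ≤ k → ∀ N →
  Σ ℕ (λ n → N ≤ n × Σ (Vec ℕ n) (λ a → T (inA n a) × coeff (p n) a ≡ k))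
coefficient-recurs k 1≤k N =
  let ((a , a∈A , rank-a) , coeff≡) = ith-coefficient (suc (N + k)) (suc (suc N)) (s≤s (s≤s z≤n)) i≤n
  in suc (N + k) , ≤-trans (m≤m+n N k) (n≤1+n _) , a , a∈A , trans (coeff≡ a a∈A rank-a) value
  where
  i≤n : suc (suc N) ≤ suc (N + k)
  i≤n = s≤s (subst (_≤ N + k) (+-comm N 1) (+-monoʳ-≤ N 1≤k))
  value : suc (N + k) + 1 ∸ suc (suc N) ≡ k
  value rewrite +-comm (N + k) 1 = m+n∸m≡n N k

lemma4 : ((n i : ℕ) → 2 ≤ i → i ≤ n →
           Σ (Vec ℕ n) (λ a → T (inA n a) × rank n a ≡ i ∸ 1)
           × ((a : Vec ℕ n) → T (inA n a) → rank n a ≡ i ∸ 1 →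
              coeff (p n) a ≡ n + 1 ∸ i))
         × ((k : ℕ) → 1 ≤ k → (N : ℕ) →
           Σ ℕ (λ n → N ≤ n × Σ (Vec ℕ n) (λ a → T (inA n a) × coeff (p n) a ≡ k)))
lemma4 = ith-coefficient , coefficient-recurs
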